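{- A graph $G$ without isolated vertices satisfies $\mathbb{E}\rho(G)\ge 1-2^{1-|V(G)|}$, with equality if and only if $G$ is a star or a complete graph.
   Context: Graphs are finite and simple. $\rho_G(X)$ is the binary rank of the $X\times(V(G)\setminus X)$ adjacency submatrix; $\mathbb{E}\rho(G)=2^{ -|V(G)|}\sum_{S\subseteq V(G)}\rho_G(S)$. A star is $K_{1,k}$ for some $k\ge1$. -}

module Defs where

open import Data.Nat using (ℕ; zero; suc; _+_; _⊔_; _≤_)
open import Data.Bool using (Bool; true; false; _∧_; _∨_; not; _xor_; if_then_else_)
open import Data.Fin using (Fin; zero; suc)
open import Data.List using (List; []; _∷_; concatMap; map; foldr; allFin)
open import Data.Nat.ListAction using (sum)
open import Data.Bool.ListAction using (and)
open import Data.Product using (Σ; ∃; _×_)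
open import Data.Sum using (_⊎_)
open import Relation.Binary.PropositionalEquality using (_≡_; _≢_)
open import Function.Bundles using (_⇔_)

record Graph (n : ℕ) : Set where
  field
    adj    : Fin n → Fin n → Bool
    sym    : ∀ u v → adj u v ≡ adj v u
    irrefl : ∀ v → adj v v ≡ false
open Graph public

VSet : ℕ → Set
VSet n = Fin n → Bool

subsets : (n : ℕ) → List (VSet n)
subsets zero    = (λ ()) ∷ []
subsets (suc n) = concatMap
  (λ S → (λ { zero → false ; (suc i) → S i }) ∷ (λ { zero → true ; (suc i) → S i }) ∷ [])
  (subsets n)

card : {n : ℕ} → VSet n → ℕ
card {n} U = sum (map (λ x → if U x then 1 else 0) (allFin n))

_⊆ᵇ_ : {n : ℕ} → VSet n → VSet n → Bool
_⊆ᵇ_ {n} U T = and (map (λ x → not (U x) ∨ T x) (allFin n))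

rowSum : {m n : ℕ} → (Fin m → Fin n → Bool) → VSet m → (Fin n → Bool)
rowSum {m} M U = foldr (λ x acc y → (U x ∧ M x y) xor acc y) (λ _ → false) (allFin m)

isZeroᵇ : {n : ℕ} → (Fin n → Bool) → Bool
isZeroᵇ {n} v = and (map (λ y → not (v y)) (allFin n))

independentᵇ : {m n : ℕ} → (Fin m → Fin n → Bool) → VSet m → Bool
independentᵇ {m} M T =
  and (map (λ U → if (U ⊆ᵇ T) ∧ not (isZeroᵇ U) then not (isZeroᵇ (rowSum M U)) else true)
           (subsets m))

rankRows : {m n : ℕ} → (Fin m → Fin n → Bool) → VSet m → ℕ
rankRows {m} M R =
  foldr _⊔_ 0 (map (λ T → if (T ⊆ᵇ R) ∧ independentᵇ M T then card T else 0) (subsets m))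

-- The X × (V∖X) adjacency submatrix, padded with zero columns for y ∈ X
-- (zero columns do not change the rank).
cutMatrix : {n : ℕ} → Graph n → VSet n → Fin n → Fin n → Bool
cutMatrix G X x y = not (X y) ∧ adj G x y

cutRank : {n : ℕ} → Graph n → VSet n → ℕ
cutRank G X = rankRows (cutMatrix G X) X

-- Σ_{S ⊆ V(G)} ρ_G(S)  (= 2^|V(G)| · 𝔼ρ(G)).
totalCutRank : {n : ℕ} → Graph n → ℕ
totalCutRank {n} G = sum (map (cutRank G) (subsets n))

NoIsolatedVertices : {n : ℕ} → Graph n → Set
NoIsolatedVertices G = ∀ v → ∃ λ u → adj G v u ≡ true

IsComplete : {n : ℕ} → Graph n → Set
IsComplete G = ∀ u v → u ≢ v → adj G u v ≡ true

IsStar : {n : ℕ} → Graph n → Set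
IsStar {n} G = Σ (Fin n) λ c →
  (∃ λ v → v ≢ c) ×
  (∀ u v → (adj G u v ≡ true) ⇔ ((u ≢ v) × (u ≡ c ⊎ v ≡ c)))

-- Write w(S) = ρ(S) + [S = ∅] + [S = V]; the 2^n values w(S) sum to Σ_S ρ(S) + 2.
-- If G has an induced 2K₂ with edges a₁b₁ and a₂b₂, then ρ(S) is at least the number of
-- these two edges that cross S, and each edge crosses exactly half of all subsets, so
-- Σ_S ρ(S) ≥ 2^n and the bound is strict.  Otherwise, since G has no isolated vertices
-- either, every cut other than ∅ and V is crossed by an edge, so w ≥ 1; equality then
-- forces ρ ≤ 1 on every cut.  For the cuts {p, q} this says that two vertices with
-- neighbours outside {p, q} share all of them, which leaves only stars and complete graphs.
-- Conversely every cut of a star or of a complete graph has rank at most 1, and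
-- ρ(∅) = ρ(V) = 0, so w ≤ 1 everywhere.

module Submission where

open import Defs renaming (sym to adj-sym)
open import Data.Nat using (ℕ; _+_; _^_; _≤_)
open import Data.Product using (_×_)
open import Data.Sum using (_⊎_)
open import Relation.Binary.PropositionalEquality using (_≡_)
open import Function.Bundles using (_⇔_)

open import Algebra.Properties.CommutativeSemigroup using (interchange)
open import Data.Bool using (Bool; true; false; _∧_; _∨_; not; _xor_; if_then_else_)
import Data.Bool as B
open import Data.Bool.ListAction using (and)
open import Data.Bool.Properties using (T-≡; not-injective; ¬-not; xor-comm; xor-identityʳ; xor-same; ∧-zeroʳ)
open import Data.Empty using (⊥; ⊥-elim)
open import Data.Fin using (Fin; zero; suc; _≟_)
open import Data.Fin.Properties using (any?; suc-injective)
open import Data.List using (List; []; _∷_; map; allFin; concatMap; foldr; tabulate)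
open import Data.List.Membership.Propositional.Properties using (∈-allFin)
open import Data.List.Properties using (map-cong; map-tabulate; foldr-preservesᵇ; foldr-preservesᵒ)
open import Data.List.Relation.Unary.All as All using (All)
open import Data.List.Relation.Unary.All.Properties as All using (all⁺; all⁻; tabulate⁺)
open import Data.List.Relation.Unary.Any as Any using (Any; here; there)
open import Data.List.Relation.Unary.Any.Properties as Any using (concatMap⁺)
open import Data.Nat using (zero; suc; _⊔_; z≤n; s≤s)
open import Data.Nat.ListAction using (sum)
open import Data.Nat.Properties
  using ( ≤-reflexive; ≤-trans; ≤-antisym; n≤0⇒n≡0; m≤m+n; m≤n+m; m+1+n≰m
        ; +-assoc; +-identityʳ; +-mono-≤; +-monoˡ-≤; +-monoʳ-≤; +-cancelˡ-≤; +-cancelʳ-≤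
        ; ⊔-lub; m≤m⊔n; m≤n⊔m; +-commutativeSemigroup)
open import Data.Product using (∃; ∃₂; _,_; proj₂)
open import Data.Sum using (inj₁; inj₂; [_,_]′)
open import Data.Vec.Functional using () renaming (_∷_ to _◃_)
open import Function.Base using (_∘_; id; case_of_)
open import Function.Bundles using (mk⇔; Equivalence)
open import Relation.Binary.Core using (_Preserves_⟶_)
open import Relation.Binary.PropositionalEquality
  using (_≢_; _≗_; refl; sym; trans; cong; cong₂; subst; subst₂; module ≡-Reasoning)
open import Relation.Nullary using (¬_; Dec; yes; no; does)
open import Relation.Nullary.Decidable using (dec-true; dec-false; ¬?; _×-dec_; map′)

open ≡-Reasoning

private variable
  k m n : ℕ

𝟙 : Bool → ℕ
𝟙 b = if b then 1 else 0

_⊆_ : VSet n → VSet n → Set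
U ⊆ T = ∀ i → U i ≡ true → T i ≡ true

∁ : VSet n → VSet n
∁ S i = not (S i)

module _ {A : Set} {p : A → Bool} where

  and-map⁺ : ∀ {xs} → All (λ x → p x ≡ true) xs → and (map p xs) ≡ true
  and-map⁺ h = Equivalence.to T-≡ (all⁻ p (All.map (Equivalence.from T-≡) h))

  and-map⁻ : ∀ xs → and (map p xs) ≡ true → All (λ x → p x ≡ true) xs
  and-map⁻ xs h = All.map (Equivalence.to T-≡) (all⁺ p xs (Equivalence.from T-≡ h))

and-allFin⇔ : {p : Fin n → Bool} → and (map p (allFin n)) ≡ true ⇔ (∀ i → p i ≡ true)
and-allFin⇔ = mk⇔ (λ h i → All.lookup (and-map⁻ _ h) (∈-allFin i)) (λ h → and-map⁺ (tabulate⁺ h))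

not≡true⇔ : ∀ {b} → not b ≡ true ⇔ b ≡ false
not≡true⇔ = mk⇔ not-injective (cong not)

not∨≡true⇔ : ∀ {a b} → not a ∨ b ≡ true ⇔ (a ≡ true → b ≡ true)
not∨≡true⇔ {true}  = mk⇔ (λ b≡true _ → b≡true) (λ h → h refl)
not∨≡true⇔ {false} = mk⇔ (λ _ ()) (λ _ → refl)

⊆ᵇ⇔ : {U T : VSet n} → (U ⊆ᵇ T) ≡ true ⇔ U ⊆ T
⊆ᵇ⇔ = mk⇔ (λ h i → Equivalence.to not∨≡true⇔ (Equivalence.to and-allFin⇔ h i))
           (λ h → Equivalence.from and-allFin⇔ (λ i → Equivalence.from not∨≡true⇔ (h i)))

isZeroᵇ⇔ : {v : Fin n → Bool} → isZeroᵇ v ≡ true ⇔ (∀ i → v i ≡ false)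
isZeroᵇ⇔ = mk⇔ (λ h i → Equivalence.to not≡true⇔ (Equivalence.to and-allFin⇔ h i))
               (λ h → Equivalence.from and-allFin⇔ (λ i → Equivalence.from not≡true⇔ (h i)))

isZeroᵇ-false : {v : Fin n → Bool} (i : Fin n) → v i ≡ true → isZeroᵇ v ≡ false
isZeroᵇ-false {v = v} i vi≡true with isZeroᵇ v in e
... | false = refl
... | true with () ← trans (sym vi≡true) (Equivalence.to isZeroᵇ⇔ e i)

isZeroᵇ-false⁻ : {v : Fin n → Bool} → isZeroᵇ v ≡ false → ∃ λ i → v i ≡ true
isZeroᵇ-false⁻ {v = v} e with any? (λ i → v i B.≟ true)
... | yes witness = witness
... | no ∄ with () ← trans (sym e) (Equivalence.from isZeroᵇ⇔ (λ i → ¬-not (λ vi → ∄ (i , vi))))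

single : Fin n → VSet n
single x k = does (k ≟ x)

pair : Fin n → Fin n → VSet n
pair x y k = single x k ∨ single y k

single-self : (x : Fin n) → single x x ≡ true
single-self x = dec-true (x ≟ x) refl

single-other : {x k : Fin n} → k ≢ x → single x k ≡ false
single-other {x = x} {k} = dec-false (k ≟ x)

single-true : {x k : Fin n} → single x k ≡ true → k ≡ x
single-true {x = x} {k} e with k ≟ x
... | yes k≡x = k≡x

pair-left : (x y : Fin n) → pair x y x ≡ true
pair-left x y = cong (_∨ single y x) (single-self x)

pair-right : (x y : Fin n) → pair x y y ≡ true
pair-right x y with single x y
... | true  = refl
... | false = single-self y

pair-other : {x y k : Fin n} → k ≢ x → k ≢ y → pair x y k ≡ false
pair-other k≢x k≢y = cong₂ _∨_ (single-other k≢x) (single-other k≢y)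

pair-true : {x y k : Fin n} → pair x y k ≡ true → k ≡ x ⊎ k ≡ y
pair-true {x = x} {y} {k} e with single x k in kx
... | true  = inj₁ (single-true kx)
... | false = inj₂ (single-true e)

⊆single : {U : VSet n} {x k : Fin n} → U ⊆ single x → k ≢ x → U k ≡ false
⊆single {U = U} {k = k} U⊆ k≢x with U k in e
... | false = refl
... | true  = ⊥-elim (k≢x (single-true (U⊆ k e)))

⊆pair : {U : VSet n} {x y k : Fin n} → U ⊆ pair x y → k ≢ x → k ≢ y → U k ≡ false
⊆pair {U = U} {k = k} U⊆ k≢x k≢y with U k in e
... | false = refl
... | true with pair-true (U⊆ k e)
...   | inj₁ k≡x = ⊥-elim (k≢x k≡x)
...   | inj₂ k≡y = ⊥-elim (k≢y k≡y)

single⊆ : {T : VSet n} {x : Fin n} → T x ≡ true → single x ⊆ T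
single⊆ {T = T} {x} Tx k e = subst (λ j → T j ≡ true) (sym (single-true {x = x} {k} e)) Tx

pair⊆ : {T : VSet n} {x y : Fin n} → T x ≡ true → T y ≡ true → pair x y ⊆ T
pair⊆ {x = x} {y} Tx Ty k e with pair-true {x = x} {y} {k} e
... | inj₁ refl = Tx
... | inj₂ refl = Ty

-- Sums over GF(2)

xorSum : (Fin n → Bool) → Bool
xorSum {zero}  f = false
xorSum {suc n} f = f zero xor xorSum (f ∘ suc)

xorSum-cong : {f g : Fin n → Bool} → f ≗ g → xorSum f ≡ xorSum g
xorSum-cong {zero}  f≗g = refl
xorSum-cong {suc n} f≗g = cong₂ _xor_ (f≗g zero) (xorSum-cong (f≗g ∘ suc))

xorSum-zero : {f : Fin n → Bool} → (∀ k → f k ≡ false) → xorSum f ≡ false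
xorSum-zero {zero}  f≡0 = refl
xorSum-zero {suc n} f≡0 = cong₂ _xor_ (f≡0 zero) (xorSum-zero (f≡0 ∘ suc))

xorSum-single : {f : Fin n → Bool} (x : Fin n) → (∀ k → k ≢ x → f k ≡ false) → xorSum f ≡ f x
xorSum-single {suc n} {f} zero h =
  trans (cong (f zero xor_) (xorSum-zero (λ k → h (suc k) λ ()))) (xor-identityʳ (f zero))
xorSum-single {suc n} (suc x) h =
  cong₂ _xor_ (h zero λ ()) (xorSum-single x (λ k k≢x → h (suc k) (k≢x ∘ suc-injective)))

xorSum-pair : {f : Fin n → Bool} (x y : Fin n) → x ≢ y → (∀ k → k ≢ x → k ≢ y → f k ≡ false) →
              xorSum f ≡ f x xor f y
xorSum-pair zero    zero    x≢y h = ⊥-elim (x≢y refl)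
xorSum-pair {f = f} zero (suc y) x≢y h =
  cong (f zero xor_) (xorSum-single y (λ k k≢y → h (suc k) (λ ()) (k≢y ∘ suc-injective)))
xorSum-pair {f = f} (suc x) zero x≢y h =
  trans (cong (f zero xor_) (xorSum-single x (λ k k≢x → h (suc k) (k≢x ∘ suc-injective) (λ ()))))
        (xor-comm (f zero) (f (suc x)))
xorSum-pair (suc x) (suc y) x≢y h =
  cong₂ _xor_ (h zero (λ ()) (λ ()))
              (xorSum-pair x y (x≢y ∘ cong suc) (λ k k≢x k≢y → h (suc k) (k≢x ∘ suc-injective) (k≢y ∘ suc-injective)))

rowSum≡xorSum : (M : Fin m → Fin n → Bool) (U : VSet m) (y : Fin n) →
                rowSum M U y ≡ xorSum (λ x → U x ∧ M x y)
rowSum≡xorSum {m} M U y = fold-tabulate id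
  where
  fold-tabulate : ∀ {j} (h : Fin j → Fin m) →
    foldr (λ x acc z → (U x ∧ M x z) xor acc z) (λ _ → false) (tabulate h) y ≡ xorSum (λ i → U (h i) ∧ M (h i) y)
  fold-tabulate {zero}  h = refl
  fold-tabulate {suc j} h = cong ((U (h zero) ∧ M (h zero) y) xor_) (fold-tabulate (h ∘ suc))

map-allFin-suc : {A : Set} (f : Fin (suc n) → A) → map f (allFin (suc n)) ≡ f zero ∷ map (f ∘ suc) (allFin n)
map-allFin-suc f = cong (f zero ∷_) (trans (map-tabulate suc f) (sym (map-tabulate id (f ∘ suc))))

card-suc : (T : VSet (suc n)) → card T ≡ 𝟙 (T zero) + card (T ∘ suc)
card-suc T = cong sum (map-allFin-suc (𝟙 ∘ T))

1≤card : {T : VSet n} (x : Fin n) → T x ≡ true → 1 ≤ card T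
1≤card {T = T} zero    Tx rewrite card-suc T | Tx = s≤s z≤n
1≤card {T = T} (suc x) Tx rewrite card-suc T = ≤-trans (1≤card x Tx) (m≤n+m _ (𝟙 (T zero)))

2≤card : {T : VSet n} (x y : Fin n) → x ≢ y → T x ≡ true → T y ≡ true → 2 ≤ card T
2≤card zero zero x≢y _ _ = ⊥-elim (x≢y refl)
2≤card {T = T} zero (suc y) _ Tx Ty rewrite card-suc T | Tx = s≤s (1≤card y Ty)
2≤card {T = T} (suc x) zero _ Tx Ty rewrite card-suc T | Ty = s≤s (1≤card x Tx)
2≤card {T = T} (suc x) (suc y) x≢y Tx Ty rewrite card-suc T =
  ≤-trans (2≤card x y (x≢y ∘ cong suc) Tx Ty) (m≤n+m _ (𝟙 (T zero)))

card≡0 : {T : VSet n} → (∀ i → T i ≡ false) → card T ≡ 0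
card≡0 {zero}          _  = refl
card≡0 {suc n} {T} T≡∅ rewrite card-suc T | T≡∅ zero = card≡0 (T≡∅ ∘ suc)

card≤1 : {T : VSet n} → (∀ i j → T i ≡ true → T j ≡ true → i ≡ j) → card T ≤ 1
card≤1 {zero}          _   = z≤n
card≤1 {suc n} {T} one rewrite card-suc T with T zero in T0
... | false = card≤1 (λ i j Ti Tj → suc-injective (one (suc i) (suc j) Ti Tj))
... | true  = ≤-reflexive (cong suc (card≡0 rest-empty))
  where
  rest-empty : ∀ i → T (suc i) ≡ false
  rest-empty i = ¬-not (λ Ti → case one zero (suc i) T0 Ti of λ ())

⊆ᵇ-cong : {U U′ T T′ : VSet n} → U ≗ U′ → T ≗ T′ → (U ⊆ᵇ T) ≡ (U′ ⊆ᵇ T′)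
⊆ᵇ-cong U≗U′ T≗T′ = cong and (map-cong (λ i → cong₂ (λ a b → not a ∨ b) (U≗U′ i) (T≗T′ i)) (allFin _))

isZeroᵇ-cong : {v w : Fin n → Bool} → v ≗ w → isZeroᵇ v ≡ isZeroᵇ w
isZeroᵇ-cong v≗w = cong and (map-cong (cong not ∘ v≗w) (allFin _))

card-cong : {T T′ : VSet n} → T ≗ T′ → card T ≡ card T′
card-cong T≗T′ = cong sum (map-cong (cong 𝟙 ∘ T≗T′) (allFin _))

rowSum-cong : {M N : Fin m → Fin n → Bool} {U V : VSet m} →
              (∀ x → M x ≗ N x) → U ≗ V → rowSum M U ≗ rowSum N V
rowSum-cong {M = M} {N} {U} {V} M≗N U≗V y = begin
  rowSum M U y                ≡⟨ rowSum≡xorSum M U y ⟩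
  xorSum (λ x → U x ∧ M x y)  ≡⟨ xorSum-cong (λ x → cong₂ _∧_ (U≗V x) (M≗N x y)) ⟩
  xorSum (λ x → V x ∧ N x y)  ≡⟨ sym (rowSum≡xorSum N V y) ⟩
  rowSum N V y                ∎

check : Bool → Bool → Bool → Bool
check b z z′ = if b ∧ not z then not z′ else true

independentᵇ-cong : {M N : Fin m → Fin n → Bool} {T T′ : VSet m} →
                    (∀ x → M x ≗ N x) → T ≗ T′ → independentᵇ M T ≡ independentᵇ N T′
independentᵇ-cong {m} M≗N T≗T′ = cong and (map-cong (λ U →
  cong₂ (λ s z → check s (isZeroᵇ U) z)
        (⊆ᵇ-cong (λ _ → refl) T≗T′) (isZeroᵇ-cong (rowSum-cong {U = U} M≗N (λ _ → refl)))) (subsets m))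

rankRows-cong : {M N : Fin m → Fin n → Bool} {R R′ : VSet m} →
                (∀ x → M x ≗ N x) → R ≗ R′ → rankRows M R ≡ rankRows N R′
rankRows-cong {m} M≗N R≗R′ = cong (foldr _⊔_ 0) (map-cong (λ T →
  cong₂ (λ s i → if s ∧ i then card T else 0)
        (⊆ᵇ-cong (λ _ → refl) R≗R′) (independentᵇ-cong M≗N (λ _ → refl))) (subsets m))

cutRank-cong : (G : Graph n) {X Y : VSet n} → X ≗ Y → cutRank G X ≡ cutRank G Y
cutRank-cong G X≗Y = rankRows-cong (λ x y → cong (λ b → not b ∧ adj G x y) (X≗Y y)) X≗Y

subsets-complete : (X : VSet n) → Any (_≗ X) (subsets n)
subsets-complete {zero}  X = here (λ ())
subsets-complete {suc n} X with X zero in X0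
... | false = concatMap⁺ _ (Any.map (λ U≗ → here (λ { zero → sym X0 ; (suc i) → U≗ i }))
                                   (subsets-complete (X ∘ suc)))
... | true  = concatMap⁺ _ (Any.map (λ U≗ → there (here (λ { zero → sym X0 ; (suc i) → U≗ i })))
                                   (subsets-complete (X ∘ suc)))

All-subsets : {P : VSet n → Set} → (∀ {U V} → U ≗ V → P U → P V) → All P (subsets n) → ∀ X → P X
All-subsets resp all X = All.lookupWith (λ PU U≗X → resp U≗X PU) all (subsets-complete X)

-- Linear independence and rank over GF(2)

check⇒ : ∀ {b z z′} → check b z z′ ≡ true → b ≡ true → z ≡ false → z′ ≡ false
check⇒ h refl refl = not-injective h

check⇐ : ∀ {b z z′} → (b ≡ true → z ≡ false → z′ ≡ false) → check b z z′ ≡ true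
check⇐ {true}  {false} h = cong not (h refl refl)
check⇐ {true}  {true}  h = refl
check⇐ {false}         h = refl

ZeroRow : (Fin m → Fin n → Bool) → Fin m → Set
ZeroRow M x = ∀ y → M x y ≡ false

Independent : (Fin m → Fin n → Bool) → VSet m → Set
Independent M T = ∀ U → U ⊆ T → (∃ λ i → U i ≡ true) → ∃ λ y → rowSum M U y ≡ true

independentᵇ⇔ : {M : Fin m → Fin n → Bool} {T : VSet m} → independentᵇ M T ≡ true ⇔ Independent M T
independentᵇ⇔ {m} {n} {M} {T} = mk⇔ to from
  where
  Check : VSet m → Bool
  Check U = check (U ⊆ᵇ T) (isZeroᵇ U) (isZeroᵇ (rowSum M U))

  Check-cong : ∀ {U V} → U ≗ V → Check U ≡ true → Check V ≡ true
  Check-cong {U} {V} U≗V = subst (_≡ true) (begin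
    check (U ⊆ᵇ T) (isZeroᵇ U) (isZeroᵇ (rowSum M U))
      ≡⟨ cong₂ (λ s z → check s z (isZeroᵇ (rowSum M U))) (⊆ᵇ-cong U≗V (λ _ → refl)) (isZeroᵇ-cong U≗V) ⟩
    check (V ⊆ᵇ T) (isZeroᵇ V) (isZeroᵇ (rowSum M U))
      ≡⟨ cong (check (V ⊆ᵇ T) (isZeroᵇ V)) (isZeroᵇ-cong (rowSum-cong {M = M} {N = M} (λ _ _ → refl) U≗V)) ⟩
    check (V ⊆ᵇ T) (isZeroᵇ V) (isZeroᵇ (rowSum M V))
      ∎)

  to : independentᵇ M T ≡ true → Independent M T
  to h U U⊆T (i , Ui) = isZeroᵇ-false⁻ (check⇒ {U ⊆ᵇ T} {isZeroᵇ U}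
    (All-subsets Check-cong (and-map⁻ (subsets m) h) U) (Equivalence.from ⊆ᵇ⇔ U⊆T) (isZeroᵇ-false i Ui))

  from : Independent M T → independentᵇ M T ≡ true
  from H = and-map⁺ {p = Check} (All.universal checked (subsets m))
    where
    checked : ∀ U → Check U ≡ true
    checked U = check⇐ λ U⊆ᵇT U≢∅ →
      let y , sum≡true = H U (Equivalence.to ⊆ᵇ⇔ U⊆ᵇT) (isZeroᵇ-false⁻ U≢∅) in isZeroᵇ-false y sum≡true

module _ {M : Fin m → Fin n → Bool} {R : VSet m} where

  rankRows≤ : (∀ T → T ⊆ R → Independent M T → card T ≤ k) → rankRows M R ≤ k
  rankRows≤ {k} bound = foldr-preservesᵇ {P = _≤ k} ⊔-lub z≤n (All.map⁺ (All.universal entry≤ (subsets m)))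
    where
    entry≤ : ∀ T → (if (T ⊆ᵇ R) ∧ independentᵇ M T then card T else 0) ≤ k
    entry≤ T with T ⊆ᵇ R in T⊆R | independentᵇ M T in indep
    ... | true  | true  = bound T (Equivalence.to ⊆ᵇ⇔ T⊆R) (Equivalence.to independentᵇ⇔ indep)
    ... | true  | false = z≤n
    ... | false | _     = z≤n

  ≤rankRows : {T : VSet m} → T ⊆ R → Independent M T → card T ≤ rankRows M R
  ≤rankRows {T} T⊆R indep = foldr-preservesᵒ {P = card T ≤_} ≤-⊔ 0 _
    (inj₂ (Any.map⁺ (Any.map (λ U≗T → ≤-reflexive (sym (entry≡card U≗T))) (subsets-complete T))))
    where
    ≤-⊔ : ∀ a b → card T ≤ a ⊎ card T ≤ b → card T ≤ a ⊔ b
    ≤-⊔ a b (inj₁ ≤a) = ≤-trans ≤a (m≤m⊔n a b)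
    ≤-⊔ a b (inj₂ ≤b) = ≤-trans ≤b (m≤n⊔m a b)
    entry≡card : ∀ {U} → U ≗ T → (if (U ⊆ᵇ R) ∧ independentᵇ M U then card U else 0) ≡ card T
    entry≡card U≗T
      rewrite ⊆ᵇ-cong {T = R} U≗T (λ _ → refl) | Equivalence.from ⊆ᵇ⇔ T⊆R
            | independentᵇ-cong {M = M} {N = M} (λ _ _ → refl) U≗T | Equivalence.from independentᵇ⇔ indep
      = card-cong U≗T

  rowSum-⊆single : {U : VSet m} {x : Fin m} (y : Fin n) → U ⊆ single x → rowSum M U y ≡ U x ∧ M x y
  rowSum-⊆single {U} {x} y U⊆ =
    trans (rowSum≡xorSum M U y) (xorSum-single x (λ k k≢x → cong (_∧ M k y) (⊆single U⊆ k≢x)))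

  rowSum-⊆pair : {U : VSet m} {x₁ x₂ : Fin m} (y : Fin n) → x₁ ≢ x₂ → U ⊆ pair x₁ x₂ →
                 rowSum M U y ≡ (U x₁ ∧ M x₁ y) xor (U x₂ ∧ M x₂ y)
  rowSum-⊆pair {U} {x₁} {x₂} y x₁≢x₂ U⊆ =
    trans (rowSum≡xorSum M U y) (xorSum-pair x₁ x₂ x₁≢x₂ (λ k k≢x₁ k≢x₂ → cong (_∧ M k y) (⊆pair U⊆ k≢x₁ k≢x₂)))

  1≤rankRows : {x : Fin m} {y : Fin n} → R x ≡ true → M x y ≡ true → 1 ≤ rankRows M R
  1≤rankRows {x} {y} Rx Mxy = ≤-trans (1≤card x (single-self x)) (≤rankRows (single⊆ Rx) independent)
    where
    independent : Independent M (single x)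
    independent U U⊆ (i , Ui) with refl ← single-true {x = x} {i} (U⊆ i Ui) =
      y , trans (rowSum-⊆single y U⊆) (cong₂ _∧_ Ui Mxy)

  2≤rankRows : {x₁ x₂ : Fin m} {y₁ y₂ : Fin n} → x₁ ≢ x₂ → R x₁ ≡ true → R x₂ ≡ true →
               M x₁ y₁ ≡ true → M x₂ y₂ ≡ true → M x₁ y₂ ≡ false → 2 ≤ rankRows M R
  2≤rankRows {x₁} {x₂} {y₁} {y₂} x₁≢x₂ Rx₁ Rx₂ M₁₁ M₂₂ M₁₂ =
    ≤-trans (2≤card x₁ x₂ x₁≢x₂ (pair-left x₁ x₂) (pair-right x₁ x₂)) (≤rankRows (pair⊆ Rx₁ Rx₂) independent)
    where
    independent : Independent M (pair x₁ x₂)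
    independent U U⊆ (i , Ui) with U x₁ in U₁ | U x₂ in U₂
    ... | true  | false = y₁ , (begin
      rowSum M U y₁                                 ≡⟨ rowSum-⊆pair y₁ x₁≢x₂ U⊆ ⟩
      (U x₁ ∧ M x₁ y₁) xor (U x₂ ∧ M x₂ y₁)         ≡⟨ cong₂ (λ a b → (a ∧ M x₁ y₁) xor (b ∧ M x₂ y₁)) U₁ U₂ ⟩
      M x₁ y₁ xor false                             ≡⟨ xor-identityʳ _ ⟩
      M x₁ y₁                                       ≡⟨ M₁₁ ⟩
      true                                          ∎)
    ... | _     | true  = y₂ , (begin
      rowSum M U y₂                                 ≡⟨ rowSum-⊆pair y₂ x₁≢x₂ U⊆ ⟩
      (U x₁ ∧ M x₁ y₂) xor (U x₂ ∧ M x₂ y₂)         ≡⟨ cong₂ (λ a b → (U x₁ ∧ a) xor (b ∧ M x₂ y₂)) M₁₂ U₂ ⟩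
      (U x₁ ∧ false) xor M x₂ y₂                    ≡⟨ cong (_xor M x₂ y₂) (∧-zeroʳ (U x₁)) ⟩
      M x₂ y₂                                       ≡⟨ M₂₂ ⟩
      true                                          ∎)
    ... | false | false with pair-true {x = x₁} {x₂} {i} (U⊆ i Ui)
    ...   | inj₁ refl with () ← trans (sym U₁) Ui
    ...   | inj₂ refl with () ← trans (sym U₂) Ui

  Independent⇒¬ZeroRow : {T : VSet m} {i : Fin m} → Independent M T → T i ≡ true → ¬ ZeroRow M i
  Independent⇒¬ZeroRow {i = i} indep Ti Mi≡0 with y , sum≡true ← indep (single i) (single⊆ Ti) (i , single-self i)
    with () ← trans (sym sum≡true) (trans (rowSum-⊆single y (λ _ → id)) (cong₂ _∧_ (single-self i) (Mi≡0 y)))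

  Independent⇒distinctRows : {T : VSet m} {i j : Fin m} → Independent M T → i ≢ j →
                             T i ≡ true → T j ≡ true → ¬ M i ≗ M j
  Independent⇒distinctRows {i = i} {j} indep i≢j Ti Tj Mi≗Mj
    with y , sum≡true ← indep (pair i j) (pair⊆ Ti Tj) (i , pair-left i j)
    with () ← trans (sym sum≡true) (begin
      rowSum M (pair i j) y                          ≡⟨ rowSum-⊆pair y i≢j (λ _ → id) ⟩
      (pair i j i ∧ M i y) xor (pair i j j ∧ M j y)  ≡⟨ cong₂ (λ a b → (a ∧ M i y) xor (b ∧ M j y))
                                                               (pair-left i j) (pair-right i j) ⟩
      M i y xor M j y                                ≡⟨ cong (M i y xor_) (sym (Mi≗Mj y)) ⟩
      M i y xor M i y                                ≡⟨ xor-same (M i y) ⟩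
      false                                          ∎)

  rankRows≤1 : (∀ x x′ → x ≢ x′ → R x ≡ true → R x′ ≡ true → ZeroRow M x ⊎ ZeroRow M x′ ⊎ M x ≗ M x′) →
               rankRows M R ≤ 1
  rankRows≤1 H = rankRows≤ λ T T⊆R indep → card≤1 (atMostOne T⊆R indep)
    where
    atMostOne : ∀ {T} → T ⊆ R → Independent M T → ∀ i j → T i ≡ true → T j ≡ true → i ≡ j
    atMostOne T⊆R indep i j Ti Tj with i ≟ j
    ... | yes i≡j = i≡j
    ... | no i≢j with H i j i≢j (T⊆R i Ti) (T⊆R j Tj)
    ...   | inj₁ Mi≡0         = ⊥-elim (Independent⇒¬ZeroRow indep Ti Mi≡0)
    ...   | inj₂ (inj₁ Mj≡0)  = ⊥-elim (Independent⇒¬ZeroRow indep Tj Mj≡0)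
    ...   | inj₂ (inj₂ Mi≗Mj) = ⊥-elim (Independent⇒distinctRows indep i≢j Ti Tj Mi≗Mj)

  rankRows≡0 : (∀ x → R x ≡ true → ZeroRow M x) → rankRows M R ≡ 0
  rankRows≡0 H = n≤0⇒n≡0 (rankRows≤ λ T T⊆R indep →
    ≤-reflexive (card≡0 (λ i → ¬-not (λ Ti → Independent⇒¬ZeroRow indep Ti (H i (T⊆R i Ti))))))

-- Sums over all subsets

module _ {A : Set} where

  sum-map-+ : (f g : A → ℕ) (xs : List A) → sum (map (λ x → f x + g x) xs) ≡ sum (map f xs) + sum (map g xs)
  sum-map-+ f g []       = refl
  sum-map-+ f g (x ∷ xs) =
    trans (cong (f x + g x +_) (sum-map-+ f g xs)) (interchange +-commutativeSemigroup (f x) (g x) _ _)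

  sum-map-mono : {f g : A → ℕ} → (∀ x → f x ≤ g x) → (xs : List A) → sum (map f xs) ≤ sum (map g xs)
  sum-map-mono f≤g []       = z≤n
  sum-map-mono f≤g (x ∷ xs) = +-mono-≤ (f≤g x) (sum-map-mono f≤g xs)

  sum-map-tight : {f g : A → ℕ} → (∀ x → f x ≤ g x) → (xs : List A) →
                  sum (map g xs) ≤ sum (map f xs) → All (λ x → g x ≤ f x) xs
  sum-map-tight f≤g []       _ = All.[]
  sum-map-tight {f} {g} f≤g (x ∷ xs) Σg≤Σf =
      +-cancelʳ-≤ _ (g x) (f x) (≤-trans Σg≤Σf (+-monoʳ-≤ (f x) (sum-map-mono f≤g xs)))
    All.∷ sum-map-tight f≤g xs (+-cancelˡ-≤ (g x) _ _ (≤-trans Σg≤Σf (+-monoˡ-≤ _ (f≤g x))))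

  sum-concatMap-pair : (f : A → ℕ) {B : Set} (g h : B → A) (xs : List B) →
    sum (map f (concatMap (λ x → g x ∷ h x ∷ []) xs)) ≡ sum (map (λ x → f (g x) + f (h x)) xs)
  sum-concatMap-pair f g h []       = refl
  sum-concatMap-pair f g h (x ∷ xs) =
    trans (sym (+-assoc (f (g x)) (f (h x)) _)) (cong (f (g x) + f (h x) +_) (sum-concatMap-pair f g h xs))

sumSubsets : (VSet n → ℕ) → ℕ
sumSubsets {n} f = sum (map f (subsets n))

-- subsets (suc n) extends each S by pattern-matching lambdas, which agree with b ◃ S only pointwise.
sumSubsets-suc : {f : VSet (suc n) → ℕ} → f Preserves _≗_ ⟶ _≡_ →
                 sumSubsets f ≡ sumSubsets (λ S → f (false ◃ S) + f (true ◃ S))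
sumSubsets-suc {n} {f} resp = trans (sum-concatMap-pair f _ _ (subsets n)) (cong sum (map-cong (λ S →
  cong₂ _+_ (resp (λ { zero → refl ; (suc i) → refl })) (resp (λ { zero → refl ; (suc i) → refl }))) (subsets n)))

sumSubsets-mono : {f g : VSet n → ℕ} → (∀ S → f S ≤ g S) → sumSubsets f ≤ sumSubsets g
sumSubsets-mono {n} f≤g = sum-map-mono f≤g (subsets n)

sumSubsets-+ : (f g : VSet n → ℕ) → sumSubsets (λ S → f S + g S) ≡ sumSubsets f + sumSubsets g
sumSubsets-+ {n} f g = sum-map-+ f g (subsets n)

sumSubsets-cong : {f g : VSet n → ℕ} → (∀ S → f S ≡ g S) → sumSubsets f ≡ sumSubsets g
sumSubsets-cong {n} f≡g = cong sum (map-cong f≡g (subsets n))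

sumSubsets-double : (f : VSet n → ℕ) → sumSubsets (λ S → f S + f S) ≡ sumSubsets f + sumSubsets f
sumSubsets-double f = sumSubsets-+ f f

sumSubsets-1 : sumSubsets {n} (λ _ → 1) ≡ 2 ^ n
sumSubsets-1 {zero}  = refl
sumSubsets-1 {suc n} = begin
  sumSubsets {suc n} (λ _ → 1)
    ≡⟨ sumSubsets-suc {n} (λ _ → refl) ⟩
  sumSubsets {n} (λ _ → 1 + 1)
    ≡⟨ sumSubsets-double {n} (λ _ → 1) ⟩
  sumSubsets {n} (λ _ → 1) + sumSubsets {n} (λ _ → 1)
    ≡⟨ cong₂ _+_ (sumSubsets-1 {n}) (trans (sumSubsets-1 {n}) (sym (+-identityʳ _))) ⟩
  2 ^ suc n ∎

isZeroᵇ-suc : (v : Fin (suc n) → Bool) → isZeroᵇ v ≡ not (v zero) ∧ isZeroᵇ (v ∘ suc)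
isZeroᵇ-suc v = cong and (map-allFin-suc (not ∘ v))

sumSubsets-empty : sumSubsets {n} (𝟙 ∘ isZeroᵇ) ≡ 1
sumSubsets-empty {zero}  = refl
sumSubsets-empty {suc n} = begin
  sumSubsets {suc n} (𝟙 ∘ isZeroᵇ)
    ≡⟨ sumSubsets-suc {n} (cong 𝟙 ∘ isZeroᵇ-cong) ⟩
  sumSubsets {n} (λ S → 𝟙 (isZeroᵇ (false ◃ S)) + 𝟙 (isZeroᵇ (true ◃ S)))
    ≡⟨ sumSubsets-cong {n} (λ S → trans
         (cong₂ (λ a b → 𝟙 a + 𝟙 b) (isZeroᵇ-suc (false ◃ S)) (isZeroᵇ-suc (true ◃ S))) (+-identityʳ _)) ⟩
  sumSubsets {n} (𝟙 ∘ isZeroᵇ)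
    ≡⟨ sumSubsets-empty {n} ⟩
  1 ∎

sumSubsets-full : sumSubsets {n} (𝟙 ∘ isZeroᵇ ∘ ∁) ≡ 1
sumSubsets-full {zero}  = refl
sumSubsets-full {suc n} = begin
  sumSubsets {suc n} (𝟙 ∘ isZeroᵇ ∘ ∁)
    ≡⟨ sumSubsets-suc {n} (λ U≗V → cong 𝟙 (isZeroᵇ-cong (cong not ∘ U≗V))) ⟩
  sumSubsets {n} (λ S → 𝟙 (isZeroᵇ (∁ (false ◃ S))) + 𝟙 (isZeroᵇ (∁ (true ◃ S))))
    ≡⟨ sumSubsets-cong {n} (λ S →
         cong₂ (λ a b → 𝟙 a + 𝟙 b) (isZeroᵇ-suc (∁ (false ◃ S))) (isZeroᵇ-suc (∁ (true ◃ S)))) ⟩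
  sumSubsets {n} (𝟙 ∘ isZeroᵇ ∘ ∁)
    ≡⟨ sumSubsets-full {n} ⟩
  1 ∎

separates : Fin n → Fin n → VSet n → ℕ
separates a b S = 𝟙 (S a xor S b)

sumSubsets-separates : {a b : Fin (suc n)} → a ≢ b → sumSubsets (separates a b) ≡ 2 ^ n
sumSubsets-separates {a = zero} {zero} a≢b = ⊥-elim (a≢b refl)
sumSubsets-separates {n} {zero} {suc b} _ = begin
  sumSubsets {suc n} (separates zero (suc b))
    ≡⟨ sumSubsets-suc {n} (λ U≗V → cong₂ (λ u v → 𝟙 (u xor v)) (U≗V zero) (U≗V (suc b))) ⟩
  sumSubsets {n} (λ S → 𝟙 (S b) + 𝟙 (not (S b)))
    ≡⟨ sumSubsets-cong {n} (λ S → one-of (S b)) ⟩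
  sumSubsets {n} (λ _ → 1)
    ≡⟨ sumSubsets-1 {n} ⟩
  2 ^ n ∎
  where
  one-of : ∀ c → 𝟙 c + 𝟙 (not c) ≡ 1
  one-of true  = refl
  one-of false = refl
sumSubsets-separates {n} {suc a} {zero} a≢b =
  trans (sumSubsets-cong {suc n} (λ S → cong 𝟙 (xor-comm (S (suc a)) (S zero)))) (sumSubsets-separates (a≢b ∘ sym))
sumSubsets-separates {suc n} {suc a} {suc b} a≢b = begin
  sumSubsets {suc (suc n)} (separates (suc a) (suc b))
    ≡⟨ sumSubsets-suc {suc n} (λ U≗V → cong₂ (λ u v → 𝟙 (u xor v)) (U≗V (suc a)) (U≗V (suc b))) ⟩
  sumSubsets {suc n} (λ S → separates a b S + separates a b S)
    ≡⟨ sumSubsets-double {suc n} (separates a b) ⟩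
  sumSubsets {suc n} (separates a b) + sumSubsets (separates a b)
    ≡⟨ cong₂ _+_ half (trans half (sym (+-identityʳ _))) ⟩
  2 ^ suc n ∎
  where
  half : sumSubsets {suc n} (separates a b) ≡ 2 ^ n
  half = sumSubsets-separates {n} (a≢b ∘ cong suc)

-- Cut rank

adj-irrefl : (G : Graph n) {u v : Fin n} → adj G u v ≡ true → u ≢ v
adj-irrefl G {u} uv refl with () ← trans (sym uv) (irrefl G u)

record Induced2K₂ (G : Graph n) (a₁ b₁ a₂ b₂ : Fin n) : Set where
  field
    edge₁ : adj G a₁ b₁ ≡ true
    edge₂ : adj G a₂ b₂ ≡ true
    a₁≁a₂ : adj G a₁ a₂ ≡ false
    a₁≁b₂ : adj G a₁ b₂ ≡ false
    b₁≁a₂ : adj G b₁ a₂ ≡ false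
    b₁≁b₂ : adj G b₁ b₂ ≡ false

Has2K₂ : Graph n → Set
Has2K₂ {n} G = ∃₂ λ (a₁ b₁ : Fin n) → ∃₂ λ (a₂ b₂ : Fin n) → Induced2K₂ G a₁ b₁ a₂ b₂

module _ {G : Graph n} where

  inside≢outside : {X : VSet n} {u v : Fin n} → X u ≡ true → X v ≡ false → u ≢ v
  inside≢outside Xu Xv refl with () ← trans (sym Xu) Xv

  cutMatrix-outside : {X : VSet n} {u v : Fin n} → X v ≡ false → cutMatrix G X u v ≡ adj G u v
  cutMatrix-outside {u = u} {v} Xv = cong (λ b → not b ∧ adj G u v) Xv

  cutMatrix-inside : {X : VSet n} {u v : Fin n} → X v ≡ true → cutMatrix G X u v ≡ false
  cutMatrix-inside {u = u} {v} Xv = cong (λ b → not b ∧ adj G u v) Xv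

  1≤cutRank : {X : VSet n} {u v : Fin n} → adj G u v ≡ true → X u ≡ true → X v ≡ false → 1 ≤ cutRank G X
  1≤cutRank {X} uv Xu Xv = 1≤rankRows {M = cutMatrix G X} Xu (trans (cutMatrix-outside {X = X} Xv) uv)

  separates≤cutRank : {X : VSet n} {u v : Fin n} → adj G u v ≡ true → separates u v X ≤ cutRank G X
  separates≤cutRank {X} {u} {v} uv with X u in Xu | X v in Xv
  ... | true  | false = 1≤cutRank uv Xu Xv
  ... | false | true  = 1≤cutRank (trans (adj-sym G v u) uv) Xv Xu
  ... | true  | true  = z≤n
  ... | false | false = z≤n

  2≤cutRank : {X : VSet n} {x₁ x₂ y₁ y₂ : Fin n} → x₁ ≢ x₂ → X x₁ ≡ true → X x₂ ≡ true →
              X y₁ ≡ false → X y₂ ≡ false → adj G x₁ y₁ ≡ true → adj G x₂ y₂ ≡ true → adj G x₁ y₂ ≡ false →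
              2 ≤ cutRank G X
  2≤cutRank {X} x₁≢x₂ Xx₁ Xx₂ Xy₁ Xy₂ e₁ e₂ x₁≁y₂ = 2≤rankRows {M = cutMatrix G X} x₁≢x₂ Xx₁ Xx₂
    (trans (outside Xy₁) e₁) (trans (outside Xy₂) e₂) (trans (outside Xy₂) x₁≁y₂)
    where
    outside : ∀ {u v} → X v ≡ false → cutMatrix G X u v ≡ adj G u v
    outside = cutMatrix-outside {X = X}

  swap₁ : {a₁ b₁ a₂ b₂ : Fin n} → Induced2K₂ G a₁ b₁ a₂ b₂ → Induced2K₂ G b₁ a₁ a₂ b₂
  swap₁ {a₁} {b₁} I = record { edge₁ = trans (adj-sym G b₁ a₁) edge₁ ; edge₂ = edge₂
                             ; a₁≁a₂ = b₁≁a₂ ; a₁≁b₂ = b₁≁b₂ ; b₁≁a₂ = a₁≁a₂ ; b₁≁b₂ = a₁≁b₂ }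
    where open Induced2K₂ I

  swap₂ : {a₁ b₁ a₂ b₂ : Fin n} → Induced2K₂ G a₁ b₁ a₂ b₂ → Induced2K₂ G a₁ b₁ b₂ a₂
  swap₂ {a₂ = a₂} {b₂} I = record { edge₁ = edge₁ ; edge₂ = trans (adj-sym G b₂ a₂) edge₂
                                  ; a₁≁a₂ = a₁≁b₂ ; a₁≁b₂ = a₁≁a₂ ; b₁≁a₂ = b₁≁b₂ ; b₁≁b₂ = b₁≁a₂ }
    where open Induced2K₂ I

  2≤cutRank-2K₂ : {X : VSet n} {a₁ b₁ a₂ b₂ : Fin n} → Induced2K₂ G a₁ b₁ a₂ b₂ →
                  X a₁ ≡ true → X b₁ ≡ false → X a₂ ≡ true → X b₂ ≡ false → 2 ≤ cutRank G X
  2≤cutRank-2K₂ {a₁ = a₁} {a₂ = a₂} I Xa₁ Xb₁ Xa₂ Xb₂ = 2≤cutRank a₁≢a₂ Xa₁ Xa₂ Xb₁ Xb₂ edge₁ edge₂ a₁≁b₂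
    where
    open Induced2K₂ I
    a₁≢a₂ : a₁ ≢ a₂
    a₁≢a₂ refl with () ← trans (sym a₁≁b₂) edge₂

  2≤cutRank-crossing : {X : VSet n} {a₁ b₁ a₂ b₂ : Fin n} → Induced2K₂ G a₁ b₁ a₂ b₂ →
                       X a₁ xor X b₁ ≡ true → X a₂ xor X b₂ ≡ true → 2 ≤ cutRank G X
  2≤cutRank-crossing {X} {a₁} {b₁} {a₂} {b₂} I c₁ c₂
    with X a₁ in Xa₁ | X b₁ in Xb₁ | X a₂ in Xa₂ | X b₂ in Xb₂
  ... | true  | false | true  | false = 2≤cutRank-2K₂ I Xa₁ Xb₁ Xa₂ Xb₂
  ... | false | true  | true  | false = 2≤cutRank-2K₂ (swap₁ I) Xb₁ Xa₁ Xa₂ Xb₂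
  ... | true  | false | false | true  = 2≤cutRank-2K₂ (swap₂ I) Xa₁ Xb₁ Xb₂ Xa₂
  ... | false | true  | false | true  = 2≤cutRank-2K₂ (swap₂ (swap₁ I)) Xb₁ Xa₁ Xb₂ Xa₂
  2≤cutRank-crossing I () _ | true  | true  | _ | _
  2≤cutRank-crossing I () _ | false | false | _ | _
  2≤cutRank-crossing I _ () | _ | _ | true  | true
  2≤cutRank-crossing I _ () | _ | _ | false | false

  separates₂≤cutRank : {a₁ b₁ a₂ b₂ : Fin n} → Induced2K₂ G a₁ b₁ a₂ b₂ →
                       (X : VSet n) → separates a₁ b₁ X + separates a₂ b₂ X ≤ cutRank G X
  separates₂≤cutRank {a₁} {b₁} {a₂} {b₂} I X with X a₁ xor X b₁ in c₁ | X a₂ xor X b₂ in c₂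
  ... | true  | true  = 2≤cutRank-crossing I c₁ c₂
  ... | true  | false = subst (λ b → 𝟙 b ≤ cutRank G X) c₁ (separates≤cutRank (Induced2K₂.edge₁ I))
  ... | false | true  = subst (λ b → 𝟙 b ≤ cutRank G X) c₂ (separates≤cutRank (Induced2K₂.edge₂ I))
  ... | false | false = z≤n

  1≤cutRank-2K₂-free : ¬ Has2K₂ G → NoIsolatedVertices G →
                       {X : VSet n} {x y : Fin n} → X x ≡ true → X y ≡ false → 1 ≤ cutRank G X
  1≤cutRank-2K₂-free no2K₂ noIso {X} {x} {y} Xx Xy with noIso x | noIso y
  ... | x′ , xx′ | y′ , yy′ with X x′ in Xx′ | X y′ in Xy′
  ... | false | _     = 1≤cutRank xx′ Xx Xx′
  ... | true  | true  = 1≤cutRank (trans (adj-sym G y′ y) yy′) Xy′ Xy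
  ... | true  | false with adj G x y in xy | adj G x y′ in xy′ | adj G x′ y in x′y | adj G x′ y′ in x′y′
  ...   | true  | _     | _     | _     = 1≤cutRank xy Xx Xy
  ...   | false | true  | _     | _     = 1≤cutRank xy′ Xx Xy′
  ...   | false | false | true  | _     = 1≤cutRank x′y Xx′ Xy
  ...   | false | false | false | true  = 1≤cutRank x′y′ Xx′ Xy′
  ...   | false | false | false | false =
    ⊥-elim (no2K₂ (x , x′ , y , y′ , record { edge₁ = xx′ ; edge₂ = yy′
                                            ; a₁≁a₂ = xy ; a₁≁b₂ = xy′ ; b₁≁a₂ = x′y ; b₁≁b₂ = x′y′ }))

  cutRank-∅ : {X : VSet n} → (∀ i → X i ≡ false) → cutRank G X ≡ 0
  cutRank-∅ {X} X≡∅ = rankRows≡0 {M = cutMatrix G X} (λ x Xx → case trans (sym Xx) (X≡∅ x) of λ ())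

  cutRank-V : {X : VSet n} → (∀ i → X i ≡ true) → cutRank G X ≡ 0
  cutRank-V {X} X≡V = rankRows≡0 {M = cutMatrix G X} (λ x _ y → cutMatrix-inside {X = X} {u = x} (X≡V y))

  cutRank≤1-complete : IsComplete G → (X : VSet n) → cutRank G X ≤ 1
  cutRank≤1-complete complete X = rankRows≤1 {M = cutMatrix G X} λ x x′ _ Xx Xx′ → inj₂ (inj₂ (sameRow Xx Xx′))
    where
    sameRow : ∀ {x x′} → X x ≡ true → X x′ ≡ true → cutMatrix G X x ≗ cutMatrix G X x′
    sameRow {x} {x′} Xx Xx′ y with X y in Xy
    ... | true  = refl
    ... | false = trans (complete x y (inside≢outside Xx Xy)) (sym (complete x′ y (inside≢outside Xx′ Xy)))

  cutRank≤1-star : IsStar G → (X : VSet n) → cutRank G X ≤ 1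
  cutRank≤1-star (c , _ , star) X = rankRows≤1 {M = cutMatrix G X} rows
    where
    leaf-adj : ∀ {u} → u ≢ c → ∀ y → adj G u y ≡ does (y ≟ c)
    leaf-adj {u} u≢c y with y ≟ c
    ... | yes refl = Equivalence.from (star u y) (u≢c , inj₂ refl)
    ... | no y≢c   = ¬-not λ uy → [ u≢c , y≢c ]′ (proj₂ (Equivalence.to (star u y) uy))

    leafRow-zero : ∀ {u} → X c ≡ true → u ≢ c → ZeroRow (cutMatrix G X) u
    leafRow-zero Xc u≢c y with y ≟ c | leaf-adj u≢c y
    ... | yes refl | uy = cong₂ (λ a b → not a ∧ b) Xc uy
    ... | no _     | uy = trans (cong (not (X y) ∧_) uy) (∧-zeroʳ (not (X y)))

    rows : ∀ x x′ → x ≢ x′ → X x ≡ true → X x′ ≡ true →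
           ZeroRow (cutMatrix G X) x ⊎ ZeroRow (cutMatrix G X) x′ ⊎ cutMatrix G X x ≗ cutMatrix G X x′
    rows x x′ x≢x′ Xx Xx′ with x ≟ c | x′ ≟ c
    ... | yes refl | _        = inj₂ (inj₁ (leafRow-zero Xx (x≢x′ ∘ sym)))
    ... | no x≢c   | yes refl = inj₁ (leafRow-zero Xx′ x≢c)
    ... | no x≢c   | no x′≢c  = inj₂ (inj₂ λ y → cong (not (X y) ∧_) (trans (leaf-adj x≢c y) (sym (leaf-adj x′≢c y))))

star-of-leaves : {G : Graph n} (c : Fin n) → (∃ λ v → v ≢ c) →
                 (∀ {u} → u ≢ c → ∀ {v} → adj G u v ≡ true ⇔ v ≡ c) → IsStar G
star-of-leaves {G = G} c leafExists leaf = c , leafExists , λ u v → mk⇔ (to u v) (from u v)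
  where
  to : ∀ u v → adj G u v ≡ true → u ≢ v × (u ≡ c ⊎ v ≡ c)
  to u v uv with u ≟ c
  ... | yes u≡c = adj-irrefl G uv , inj₁ u≡c
  ... | no u≢c  = adj-irrefl G uv , inj₂ (Equivalence.to (leaf u≢c) uv)
  from : ∀ u v → u ≢ v × (u ≡ c ⊎ v ≡ c) → adj G u v ≡ true
  from u v (u≢v , inj₁ refl) = trans (adj-sym G u v) (Equivalence.from (leaf (u≢v ∘ sym)) refl)
  from u v (u≢v , inj₂ refl) = Equivalence.from (leaf u≢v) refl

module _ {G : Graph n} (noIso : NoIsolatedVertices G) (cut≤1 : ∀ X → cutRank G X ≤ 1) where

  shared-neighbour : {p q y d : Fin n} → p ≢ q → y ≢ p → y ≢ q → d ≢ p → d ≢ q →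
                     adj G p y ≡ true → adj G q d ≡ true → adj G p d ≡ true
  -- Otherwise p and q have independent rows in the cut {p, q}.
  shared-neighbour {p} {q} {y} {d} p≢q y≢p y≢q d≢p d≢q py qd with adj G p d in pd
  ... | true  = refl
  ... | false with s≤s () ← ≤-trans (2≤cutRank {G = G} p≢q (pair-left p q) (pair-right p q)
                                   (pair-other {x = p} {q} y≢p y≢q) (pair-other {x = p} {q} d≢p d≢q) py qd pd)
                                 (cut≤1 (pair p q))

  twin : {p q y : Fin n} → p ≢ q → adj G p q ≡ false → adj G p y ≡ true → adj G q y ≡ true
  twin {p} {q} {y} p≢q p≁q py with d , qd ← noIso q =
    shared-neighbour (p≢q ∘ sym) (adj-irrefl G qd ∘ sym) d≢p y≢q (adj-irrefl G py ∘ sym) qd py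
    where
    d≢p : d ≢ p
    d≢p refl with () ← trans (sym p≁q) (trans (adj-sym G p q) qd)
    y≢q : y ≢ q
    y≢q refl with () ← trans (sym p≁q) py

  star : {a b : Fin n} → a ≢ b → adj G a b ≡ false → IsStar G
  star {a} {b} a≢b a≁b with c , ac ← noIso a = star-of-leaves {G = G} c (a , adj-irrefl G ac) leaf
    where
    bc : adj G b c ≡ true
    bc = twin a≢b a≁b ac

    a-leaf : ∀ {e} → adj G a e ≡ true → e ≡ c
    a-leaf {e} ae with e ≟ c
    ... | yes e≡c = e≡c
    ... | no e≢c with () ← trans (sym a≁b)
          (shared-neighbour (adj-irrefl G ac) (adj-irrefl G ae ∘ sym) e≢c (a≢b ∘ sym) (adj-irrefl G bc)
                            ae (trans (adj-sym G c b) bc))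

    leaf : ∀ {u} → u ≢ c → ∀ {v} → adj G u v ≡ true ⇔ v ≡ c
    leaf {u} u≢c with u ≟ a
    ... | yes refl = mk⇔ a-leaf (λ { refl → ac })
    ... | no u≢a   = mk⇔ (λ uv → a-leaf (twin u≢a u≁a uv)) (λ { refl → twin (u≢a ∘ sym) a≁u ac })
      where
      u≁a : adj G u a ≡ false
      u≁a = ¬-not λ ua → u≢c (a-leaf (trans (adj-sym G a u) ua))
      a≁u : adj G a u ≡ false
      a≁u = trans (adj-sym G a u) u≁a

  star-or-complete : IsStar G ⊎ IsComplete G
  star-or-complete with any? (λ a → any? (λ b → ¬? (a ≟ b) ×-dec (adj G a b B.≟ false)))
  ... | yes (a , b , a≢b , a≁b) = inj₁ (star a≢b a≁b)
  ... | no ∄                   = inj₂ λ u v u≢v → ¬-not λ u≁v → ∄ (u , v , u≢v , u≁v)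

has2K₂? : (G : Graph n) → Dec (Has2K₂ G)
has2K₂? G = any? λ a₁ → any? λ b₁ → any? λ a₂ → any? λ b₂ →
  map′ (λ (e₁ , e₂ , n₁ , n₂ , n₃ , n₄) →
          record { edge₁ = e₁ ; edge₂ = e₂ ; a₁≁a₂ = n₁ ; a₁≁b₂ = n₂ ; b₁≁a₂ = n₃ ; b₁≁b₂ = n₄ })
       (λ I → let open Induced2K₂ I in edge₁ , edge₂ , a₁≁a₂ , a₁≁b₂ , b₁≁a₂ , b₁≁b₂)
       (adj G a₁ b₁ B.≟ true ×-dec adj G a₂ b₂ B.≟ true ×-dec adj G a₁ a₂ B.≟ false ×-dec
        adj G a₁ b₂ B.≟ false ×-dec adj G b₁ a₂ B.≟ false ×-dec adj G b₁ b₂ B.≟ false)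

weight : Graph n → VSet n → ℕ
weight G S = cutRank G S + 𝟙 (isZeroᵇ S) + 𝟙 (isZeroᵇ (∁ S))

sumSubsets-weight : (G : Graph n) → sumSubsets (weight G) ≡ totalCutRank G + 2
sumSubsets-weight {n} G = begin
  sumSubsets (weight G)
    ≡⟨ sumSubsets-+ {n} (λ S → cutRank G S + 𝟙 (isZeroᵇ S)) (𝟙 ∘ isZeroᵇ ∘ ∁) ⟩
  sumSubsets {n} (λ S → cutRank G S + 𝟙 (isZeroᵇ S)) + sumSubsets {n} (𝟙 ∘ isZeroᵇ ∘ ∁)
    ≡⟨ cong₂ _+_ (sumSubsets-+ {n} (cutRank G) (𝟙 ∘ isZeroᵇ)) (sumSubsets-full {n}) ⟩
  totalCutRank G + sumSubsets {n} (𝟙 ∘ isZeroᵇ) + 1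
    ≡⟨ cong (λ k → totalCutRank G + k + 1) (sumSubsets-empty {n}) ⟩
  totalCutRank G + 1 + 1
    ≡⟨ +-assoc (totalCutRank G) 1 1 ⟩
  totalCutRank G + 2 ∎

cutRank≤weight : (G : Graph n) (S : VSet n) → cutRank G S ≤ weight G S
cutRank≤weight G S = ≤-trans (m≤m+n _ _) (m≤m+n _ _)

1≤weight : {G : Graph n} → ¬ Has2K₂ G → NoIsolatedVertices G → (S : VSet n) → 1 ≤ weight G S
1≤weight {G = G} no2K₂ noIso S with isZeroᵇ S in S≡∅ | isZeroᵇ (∁ S) in S≡V
... | true  | _     = ≤-trans (m≤n+m 1 (cutRank G S)) (m≤m+n _ _)
... | false | true  = m≤n+m 1 _
... | false | false
  with _ , Sx ← isZeroᵇ-false⁻ {v = S} S≡∅ | _ , ∁Sy ← isZeroᵇ-false⁻ {v = ∁ S} S≡V =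
  ≤-trans (1≤cutRank-2K₂-free no2K₂ noIso Sx (Equivalence.to not≡true⇔ ∁Sy))
          (≤-reflexive (sym (trans (+-identityʳ _) (+-identityʳ _))))

weight≤1 : {G : Graph (suc n)} → (∀ X → cutRank G X ≤ 1) → (S : VSet (suc n)) → weight G S ≤ 1
weight≤1 {G = G} cut≤1 S with isZeroᵇ S in S≡∅
... | true = ≤-reflexive (cong₂ (λ r b → r + 1 + 𝟙 b)
                            (cutRank-∅ {G = G} S≡∅′) (isZeroᵇ-false {v = ∁ S} zero (cong not (S≡∅′ zero))))
  where
  S≡∅′ : ∀ i → S i ≡ false
  S≡∅′ = Equivalence.to isZeroᵇ⇔ S≡∅
... | false with isZeroᵇ (∁ S) in S≡V
...   | true  = ≤-reflexive (cong (λ r → r + 0 + 1) (cutRank-V {G = G} S≡V′))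
  where
  S≡V′ : ∀ i → S i ≡ true
  S≡V′ i = not-injective (Equivalence.to isZeroᵇ⇔ S≡V i)
...   | false = ≤-trans (≤-reflexive (trans (+-identityʳ _) (+-identityʳ _))) (cut≤1 S)

2^n≤totalCutRank : {G : Graph (suc n)} → Has2K₂ G → 2 ^ suc n ≤ totalCutRank G
2^n≤totalCutRank {n} {G} (a₁ , b₁ , a₂ , b₂ , I) =
  subst (_≤ totalCutRank G) count (sumSubsets-mono (separates₂≤cutRank I))
  where
  open Induced2K₂ I
  count : sumSubsets (λ X → separates a₁ b₁ X + separates a₂ b₂ X) ≡ 2 ^ suc n
  count = begin
    sumSubsets (λ X → separates a₁ b₁ X + separates a₂ b₂ X)
      ≡⟨ sumSubsets-+ (separates a₁ b₁) (separates a₂ b₂) ⟩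
    sumSubsets (separates a₁ b₁) + sumSubsets (separates a₂ b₂)
      ≡⟨ cong₂ _+_ (sumSubsets-separates (adj-irrefl G edge₁)) (sumSubsets-separates (adj-irrefl G edge₂)) ⟩
    2 ^ n + 2 ^ n
      ≡⟨ cong (2 ^ n +_) (+-identityʳ _) ⟨
    2 ^ suc n ∎

module _ {G : Graph n} where

  2^n≤totalCutRank+2 : ¬ Has2K₂ G → NoIsolatedVertices G → 2 ^ n ≤ totalCutRank G + 2
  2^n≤totalCutRank+2 no2K₂ noIso =
    subst₂ _≤_ (sumSubsets-1 {n}) (sumSubsets-weight G) (sumSubsets-mono {n} (1≤weight no2K₂ noIso))

  cutRank≤1-of-tight : ¬ Has2K₂ G → NoIsolatedVertices G → totalCutRank G + 2 ≡ 2 ^ n → ∀ X → cutRank G X ≤ 1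
  cutRank≤1-of-tight no2K₂ noIso tight = All-subsets (λ U≗V → subst (_≤ 1) (cutRank-cong G U≗V))
    (All.map (≤-trans (cutRank≤weight G _))
      (sum-map-tight (1≤weight no2K₂ noIso) (subsets n)
        (≤-reflexive (trans (sumSubsets-weight G) (trans tight (sym (sumSubsets-1 {n})))))))

totalCutRank+2≤2^n : {G : Graph (suc n)} → (∀ X → cutRank G X ≤ 1) → totalCutRank G + 2 ≤ 2 ^ suc n
totalCutRank+2≤2^n {n} {G} cut≤1 =
  subst₂ _≤_ (sumSubsets-weight G) (sumSubsets-1 {suc n}) (sumSubsets-mono {suc n} (weight≤1 {G = G} cut≤1))

cutRank≤1 : {G : Graph n} → IsStar G ⊎ IsComplete G → ∀ X → cutRank G X ≤ 1
cutRank≤1 {G = G} (inj₁ star)     = cutRank≤1-star {G = G} star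
cutRank≤1 {G = G} (inj₂ complete) = cutRank≤1-complete {G = G} complete

proposition4p3 : (n : ℕ) → 1 ≤ n → (G : Graph n) → NoIsolatedVertices G →
    (2 ^ n ≤ totalCutRank G + 2)
    × ((totalCutRank G + 2 ≡ 2 ^ n) ⇔ (IsStar G ⊎ IsComplete G))
proposition4p3 (suc n) _ G noIso with has2K₂? G
... | yes 2K₂ = ≤-trans lower (m≤m+n _ 2) , mk⇔ (⊥-elim ∘ impossible ∘ ≤-reflexive) (⊥-elim ∘ impossible ∘ upper)
  where
  lower : 2 ^ suc n ≤ totalCutRank G
  lower = 2^n≤totalCutRank 2K₂
  upper : IsStar G ⊎ IsComplete G → totalCutRank G + 2 ≤ 2 ^ suc n
  upper = totalCutRank+2≤2^n {G = G} ∘ cutRank≤1 {G = G}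
  impossible : totalCutRank G + 2 ≤ 2 ^ suc n → ⊥
  impossible ≤2^n = m+1+n≰m (totalCutRank G) (≤-trans ≤2^n lower)
... | no no2K₂ = lower , mk⇔ (star-or-complete {G = G} noIso ∘ cutRank≤1-of-tight {G = G} no2K₂ noIso)
                               (λ sc → ≤-antisym (totalCutRank+2≤2^n {G = G} (cutRank≤1 {G = G} sc)) lower)
  where
  lower : 2 ^ suc n ≤ totalCutRank G + 2
  lower = 2^n≤totalCutRank+2 no2K₂ noIso
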